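{- Let $A$ be a commutative ring with identity and $HA$ the ring of Hurwitz series over $A$. Let $n\in\mathbb{N}^+$ be fixed, $z_0,\dots,z_{n-1}\in HA$ and $z=\mathrm{intl}(z_0,\dots,z_{n-1})$. Then for all $k,m\in\mathbb{N}$, $$\langle k\rangle\int^m z=\int^{k+m}\mathrm{intl}\Big(C^{k+m}_{k,n}\boxdot z_0,\ \dots,\ C^{i+k+m}_{k,n}\boxdot z_i,\ \dots,\ C^{n-1+k+m}_{k,n}\boxdot z_{n-1}\Big).$$
   Context: $HA$ is the set of sequences $f=(f(0),f(1),\dots)$ with entries in $A$, with componentwise addition and product $(fg)(m)=\sum_{i=0}^m\binom{m}{i}f(i)g(m-i)$. The integral is $\int f=(0,f(0),f(1),\dots)$ and $\int^m$ its $m$-fold iterate ($\int^0=\mathrm{id}$). $\langle k\rangle\in HA$ is given by $\langle k\rangle(i)=\delta_{i,k}$. For fixed $n$, $\widehat{q}=\lfloor q/n\rfloor$, $\overline{q}=q-\widehat{q}n$; the interlacing is $\mathrm{intl}(z_0,\dots,z_{n-1})(q)=z_{\overline{q}}(\widehat{q})$. The Hadamard product is $(f\boxdot g)(p)=f(p)g(p)$. $C^{\ell}_{k,n}\in HA$ is defined by $C^{\ell}_{k,n}(p)=\binom{\ell+pn}{k}$ (with $\binom{a}{b}=0$ if $a<b$). -}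

module Defs where

open import Level using (Level)
open import Data.Nat as ℕ using (ℕ; zero; suc; NonZero)
open import Data.Nat.DivMod using (_/_; _%_; m%n<n)
open import Data.Nat.Combinatorics using (_C_)
open import Data.Fin using (Fin; fromℕ<; toℕ)
open import Algebra.Bundles using (CommutativeRing)
import Algebra.Definitions.RawMonoid as RawMonoidDefs
open import Data.Bool using (if_then_else_)
open import Relation.Nullary.Decidable using (⌊_⌋)

module Hurwitz {c ℓ : Level} (R : CommutativeRing c ℓ) where
  open CommutativeRing R

  open RawMonoidDefs +-rawMonoid using () renaming (_×_ to _·ℕ_)

  HA : Set c
  HA = ℕ → Carrier

  _≈H_ : HA → HA → Set ℓ
  f ≈H g = ∀ i → f i ≈ g i

  sumTo : ℕ → (ℕ → Carrier) → Carrier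
  sumTo zero    t = t 0
  sumTo (suc m) t = sumTo m t + t (suc m)

  _⋆_ : HA → HA → HA
  (f ⋆ g) m = sumTo m (λ i → (m C i) ·ℕ (f i * g (m ℕ.∸ i)))

  ∫ : HA → HA
  ∫ f zero    = 0#
  ∫ f (suc i) = f i

  ∫^ : ℕ → HA → HA
  ∫^ zero    f = f
  ∫^ (suc m) f = ∫ (∫^ m f)

  ⟨_⟩ : ℕ → HA
  ⟨ k ⟩ i = if ⌊ k ℕ.≟ i ⌋ then 1# else 0#

  _⊡_ : HA → HA → HA
  (f ⊡ g) p = f p * g p

  -- C^ℓ_{k,n}(p) = binom(ℓ + p n, k)  (binom a b = 0 if a < b)
  Cs : ℕ → ℕ → ℕ → HA
  Cs l k n p = (((l ℕ.+ p ℕ.* n) C k)) ·ℕ 1#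

  -- interlacing: intl(z_0,...,z_{n-1})(q) = z_{q mod n}(q div n)
  intl : (n : ℕ) .{{_ : NonZero n}} → (Fin n → HA) → HA
  intl n z q = z (fromℕ< (m%n<n q n)) (q / n)

{-# OPTIONS --safe #-}
-- Multiplying by ⟨k⟩ shifts a Hurwitz series by k places and scales the entry
-- that lands at position k + q by binom(k + q, k): ⟨k⟩ f = ∫^k (binom(k + q, k) f(q))_q.
-- For f = ∫^m z the shifts add up to ∫^(k+m) of z scaled by binom(k + m + q, k);
-- in an interlaced z, position q = i + p n belongs to the i-th component at p,
-- which turns that scalar into the Hadamard factor C^{i+k+m}_{k,n}(p).
module Submission where

open import Defs
open import Level using (Level)
open import Data.Nat as ℕ using (ℕ; _+_; _∸_; _≤_; _<_; NonZero; zero; suc; z≤n; s≤s; _≟_; s≤s⁻¹)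
open import Data.Nat.Properties using (m+n∸m≡n; ≤-refl; m≤n⇒m≤1+n; m≤m+n; ≤∧≢⇒<; <⇒≢; <-≤-trans)
open import Data.Nat.DivMod using (_/_; _mod_; _divMod_; DivMod)
open import Data.Nat.Combinatorics using (_C_)
open import Data.Nat.Tactic.RingSolver using (solve-∀)
open import Data.Fin using (Fin; toℕ)
open import Data.Empty using (⊥-elim)
open import Relation.Nullary using (yes; no)
open import Relation.Binary.PropositionalEquality as ≡ using (_≡_; _≢_)
open import Algebra.Bundles using (CommutativeRing)
import Algebra.Properties.Semiring.Mult as SemiringMult
import Relation.Binary.Reasoning.Setoid as SetoidReasoning

interlace-index : ∀ n .{{_ : NonZero n}} q → q ≡ toℕ (q mod n) + q / n ℕ.* n
interlace-index n q = DivMod.property (q divMod n)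

module _ {c ℓ : Level} (R : CommutativeRing c ℓ) where
  open CommutativeRing R hiding (_+_)
  open Hurwitz R
  open SemiringMult semiring using (_×_; ×-congʳ; ×-assoc-*)
  open SetoidReasoning setoid

  ×-zeroʳ : ∀ a → a × 0# ≈ 0#
  ×-zeroʳ zero    = refl
  ×-zeroʳ (suc a) = trans (+-congˡ (×-zeroʳ a)) (+-identityʳ 0#)

  ×1-* : ∀ a x → (a × 1#) * x ≈ a × x
  ×1-* a x = trans (×-assoc-* a 1# x) (×-congʳ a (*-identityˡ x))

  sumTo-zero : ∀ (t : ℕ → Carrier) N → (∀ i → i ≤ N → t i ≈ 0#) → sumTo N t ≈ 0#
  sumTo-zero t zero    t≈0 = t≈0 0 z≤n
  sumTo-zero t (suc N) t≈0 =
    trans (+-cong (sumTo-zero t N (λ i i≤N → t≈0 i (m≤n⇒m≤1+n i≤N))) (t≈0 (suc N) ≤-refl))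
          (+-identityʳ 0#)

  sumTo-single : ∀ (t : ℕ → Carrier) k → (∀ i → i ≢ k → t i ≈ 0#) →
                 ∀ N → k ≤ N → sumTo N t ≈ t k
  sumTo-single t k t≈0 zero z≤n = refl
  sumTo-single t k t≈0 (suc N) k≤1+N with k ≟ suc N
  ... | yes ≡.refl =
    trans (+-congʳ (sumTo-zero t N (λ i i≤N → t≈0 i (<⇒≢ (s≤s i≤N))))) (+-identityˡ (t k))
  ... | no k≢1+N =
    trans (+-cong (sumTo-single t k t≈0 N (s≤s⁻¹ (≤∧≢⇒< k≤1+N k≢1+N)))
                  (t≈0 (suc N) (λ 1+N≡k → k≢1+N (≡.sym 1+N≡k))))
          (+-identityʳ (t k))

  ⟨⟩-diag : ∀ k → ⟨ k ⟩ k ≡ 1#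
  ⟨⟩-diag k with k ≟ k
  ... | yes _   = ≡.refl
  ... | no k≢k = ⊥-elim (k≢k ≡.refl)

  ⟨⟩-off : ∀ {k i} → i ≢ k → ⟨ k ⟩ i ≡ 0#
  ⟨⟩-off {k} {i} i≢k with k ≟ i
  ... | yes k≡i = ⊥-elim (i≢k (≡.sym k≡i))
  ... | no _    = ≡.refl

  ∫^-below : ∀ m f {j} → j < m → ∫^ m f j ≡ 0#
  ∫^-below (suc m) f {zero}  _         = ≡.refl
  ∫^-below (suc m) f {suc j} (s≤s j<m) = ∫^-below m f j<m

  ∫^-shift : ∀ m f j → ∫^ m f (m + j) ≡ f j
  ∫^-shift zero    f j = ≡.refl
  ∫^-shift (suc m) f j = ∫^-shift m f j

  ∫^-+ : ∀ k m f → ∫^ (k + m) f ≡ ∫^ k (∫^ m f)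
  ∫^-+ zero    m f = ≡.refl
  ∫^-+ (suc k) m f = ≡.cong ∫ (∫^-+ k m f)

  ∫^-cong : ∀ m {f g} → f ≈H g → ∫^ m f ≈H ∫^ m g
  ∫^-cong zero    f≈g j       = f≈g j
  ∫^-cong (suc m) f≈g zero    = refl
  ∫^-cong (suc m) f≈g (suc j) = ∫^-cong m f≈g j

  ∫^-intro : ∀ m (h f : HA) → (∀ j → j < m → h j ≈ 0#) → (∀ j → h (m + j) ≈ f j) →
             h ≈H ∫^ m f
  ∫^-intro zero    h f h≈0 h≈f j       = h≈f j
  ∫^-intro (suc m) h f h≈0 h≈f zero    = h≈0 0 (s≤s z≤n)
  ∫^-intro (suc m) h f h≈0 h≈f (suc j) =
    ∫^-intro m (λ i → h (suc i)) f (λ i i<m → h≈0 (suc i) (s≤s i<m)) h≈f j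

  ∫^-scale : ∀ m (a : ℕ → ℕ) f → (λ q → a q × ∫^ m f q) ≈H ∫^ m (λ j → a (m + j) × f j)
  ∫^-scale m a f = ∫^-intro m _ _
    (λ j j<m → trans (reflexive (≡.cong (a j ×_) (∫^-below m f j<m))) (×-zeroʳ (a j)))
    (λ j → reflexive (≡.cong (a (m + j) ×_) (∫^-shift m f j)))

  ⟨⟩-⋆ : ∀ k f → (⟨ k ⟩ ⋆ f) ≈H ∫^ k (λ q → ((k + q) C k) × f q)
  ⟨⟩-⋆ k f = ∫^-intro k _ _
    (λ p p<k → sumTo-zero (term p) p (λ i i≤p → term-off p (<⇒≢ (<-≤-trans (s≤s i≤p) p<k))))
    term-diag
    where
    term : ℕ → ℕ → Carrier
    term p i = (p C i) × (⟨ k ⟩ i * f (p ∸ i))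

    term-off : ∀ p {i} → i ≢ k → term p i ≈ 0#
    term-off p {i} i≢k = begin
      (p C i) × (⟨ k ⟩ i * f (p ∸ i)) ≡⟨ ≡.cong (λ x → (p C i) × (x * f (p ∸ i))) (⟨⟩-off i≢k) ⟩
      (p C i) × (0# * f (p ∸ i))      ≈⟨ ×-congʳ (p C i) (zeroˡ _) ⟩
      (p C i) × 0#                    ≈⟨ ×-zeroʳ (p C i) ⟩
      0#                              ∎

    term-diag : ∀ q → (⟨ k ⟩ ⋆ f) (k + q) ≈ ((k + q) C k) × f q
    term-diag q = begin
      sumTo (k + q) (term (k + q))
        ≈⟨ sumTo-single (term (k + q)) k (λ i → term-off (k + q)) (k + q) (m≤m+n k q) ⟩
      ((k + q) C k) × (⟨ k ⟩ k * f (k + q ∸ k))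
        ≡⟨ ≡.cong₂ (λ x y → ((k + q) C k) × (x * f y)) (⟨⟩-diag k) (m+n∸m≡n k q) ⟩
      ((k + q) C k) × (1# * f q)     ≈⟨ ×-congʳ ((k + q) C k) (*-identityˡ (f q)) ⟩
      ((k + q) C k) × f q            ∎

  intl-binomial-⊡ : ∀ n .{{_ : NonZero n}} (z : Fin n → HA) k m q →
    ((k + (m + q)) C k) × intl n z q ≈ intl n (λ i → Cs (toℕ i + k + m) k n ⊡ z i) q
  intl-binomial-⊡ n z k m q = begin
    ((k + (m + q)) C k) × intl n z q          ≈⟨ ×1-* ((k + (m + q)) C k) (intl n z q) ⟨
    (((k + (m + q)) C k) × 1#) * intl n z q
      ≡⟨ ≡.cong (λ a → ((a C k) × 1#) * intl n z q) position ⟩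
    intl n (λ i → Cs (toℕ i + k + m) k n ⊡ z i) q ∎
    where
    position : k + (m + q) ≡ toℕ (q mod n) + k + m + q / n ℕ.* n
    position = ≡.trans (≡.cong (λ x → k + (m + x)) (interlace-index n q))
                       (+-rearrange k m (toℕ (q mod n)) (q / n ℕ.* n))
      where
      +-rearrange : ∀ a b r d → a + (b + (r + d)) ≡ r + a + b + d
      +-rearrange = solve-∀

theorem3p8 : {c ℓ : Level} (R : CommutativeRing c ℓ) →
    let open Hurwitz R in
    (n : ℕ) .{{_ : NonZero n}} (z : Fin n → HA) (k m : ℕ) →
    (⟨ k ⟩ ⋆ ∫^ m (intl n z))
      ≈H ∫^ (k + m) (intl n (λ i → Cs (toℕ i + k + m) k n ⊡ z i))
theorem3p8 R n z k m p = begin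
  (⟨ k ⟩ ⋆ ∫^ m (intl n z)) p
    ≈⟨ ⟨⟩-⋆ R k (∫^ m (intl n z)) p ⟩
  ∫^ k (λ q → ((k + q) C k) × ∫^ m (intl n z) q) p
    ≈⟨ ∫^-cong R k (∫^-scale R m (λ q → (k + q) C k) (intl n z)) p ⟩
  ∫^ k (∫^ m (λ q → ((k + (m + q)) C k) × intl n z q)) p
    ≡⟨ ≡.cong-app (∫^-+ R k m _) p ⟨
  ∫^ (k + m) (λ q → ((k + (m + q)) C k) × intl n z q) p
    ≈⟨ ∫^-cong R (k + m) (intl-binomial-⊡ R n z k m) p ⟩
  ∫^ (k + m) (intl n (λ i → Cs (toℕ i + k + m) k n ⊡ z i)) p ∎
  where
  open CommutativeRing R using (setoid)
  open Hurwitz R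
  open SemiringMult (CommutativeRing.semiring R) using (_×_)
  open SetoidReasoning setoid
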